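{- Let $m\in\mathbb{Z}$. Then $m\ge0$ if and only if there is a nonzero integer $x$ such that $(3m-1)x^2+1$ is a perfect square of an integer. -}

module Defs where

module Submission where

-- For m < 0 the coefficient 3m − 1 is at most −4, and −c x² + 1 = y² with c ≥ 2
-- forces x = 0.  For m = 0 take x = 1.  For m ≥ 1 the number d = 3m − 1 ≡ 2
-- (mod 3) is not a square, and the claim is the solvability of Pell's equation
-- α² − d γ² = 1 with γ ≠ 0, proved here constructively for every non-square d:
--
-- Two matrices whose columns
--    have the same Gram matrix differ by an automorph of the form; its first
--    column solves Pell's equation, nontrivially unless the matrices agree up
--    to sign.
--  * ReducedForms: the continued-fraction step on reduced forms (P, Q, R) with
--    P² + Q R = d, P ≤ ⌊√d⌋, Q ≤ P + ⌊√d⌋ produces again a reduced form.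
--  * ContinuedFraction: iterating the step and accumulating the matrix of
--    partial quotients, the matrix entries grow while only finitely many reduced
--    forms exist; by pigeonhole two stages share a form, and NormForm applies.
--  * Squares: ⌊√n⌋ exists and no square is 2 modulo 3.

import Data.Nat as ℕ

module NormForm where

  open import Data.Integer using (ℤ; _+_; _*_; _-_; -_; ∣_∣; +_; 0ℤ; 1ℤ)
  open import Data.Integer.Properties using (abs-*; i*j≡0⇒i≡0∨j≡0)
  open import Data.Integer.Tactic.RingSolver using (solve-∀)
  import Data.Nat.Properties as ℕ
  open import Data.Product using (∃-syntax; _×_)
  open import Data.Sum using (inj₁; inj₂)
  open import Relation.Binary.PropositionalEquality
  open import Relation.Nullary using (contradiction)
  open ≡-Reasoning

  PellSolution : ℤ → Set
  PellSolution d = ∃[ α ] ∃[ γ ] (γ ≢ 0ℤ × α * α - d * (γ * γ) ≡ 1ℤ)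

  -- The columns (x₁, x₃) and (x₂, x₄) of the matrix (x₁ x₂ ; x₃ x₄) have the
  -- Gram matrix (A B ; B C) with respect to the form  x x′ − d z z′.
  record HasGram (d x₁ x₂ x₃ x₄ A B C : ℤ) : Set where
    field
      gram₁₁ : x₁ * x₁ - d * (x₃ * x₃) ≡ A
      gram₁₂ : x₁ * x₂ - d * (x₃ * x₄) ≡ B
      gram₂₂ : x₂ * x₂ - d * (x₄ * x₄) ≡ C

  open HasGram

  private variable
    d A B C A′ B′ C′ : ℤ
    x₁ x₂ x₃ x₄ y₁ y₂ y₃ y₄ : ℤ

  gram-cong : (f : ℤ → ℤ → ℤ → ℤ) → HasGram d x₁ x₂ x₃ x₄ A B C →
              f (x₁ * x₁ - d * (x₃ * x₃)) (x₁ * x₂ - d * (x₃ * x₄)) (x₂ * x₂ - d * (x₄ * x₄))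
                ≡ f A B C
  gram-cong f G = cong₂ (λ u v → u v) (cong₂ f (gram₁₁ G) (gram₁₂ G)) (gram₂₂ G)

  regram : A ≡ A′ → B ≡ B′ → C ≡ C′ →
           HasGram d x₁ x₂ x₃ x₄ A B C → HasGram d x₁ x₂ x₃ x₄ A′ B′ C′
  regram refl refl refl G = G

  -- Right multiplication by (a 1 ; 1 0) transforms the Gram matrix G into
  -- (a 1 ; 1 0) G (a 1 ; 1 0).
  gram-step : ∀ a → HasGram d x₁ x₂ x₃ x₄ A B C →
              HasGram d (a * x₁ + x₂) x₁ (a * x₃ + x₄) x₃ (a * a * A + + 2 * a * B + C) (a * A + B) A
  gram-step {d} {x₁} {x₂} {x₃} {x₄} a G = record
    { gram₁₁ = trans (expand₁₁ a d x₁ x₂ x₃ x₄) (gram-cong (λ u v w → a * a * u + + 2 * a * v + w) G)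
    ; gram₁₂ = trans (expand₁₂ a d x₁ x₂ x₃ x₄) (gram-cong (λ u v w → a * u + v) G)
    ; gram₂₂ = gram₁₁ G
    }
    where
    expand₁₁ : ∀ a d x₁ x₂ x₃ x₄ →
      (a * x₁ + x₂) * (a * x₁ + x₂) - d * ((a * x₃ + x₄) * (a * x₃ + x₄))
        ≡ a * a * (x₁ * x₁ - d * (x₃ * x₃)) + + 2 * a * (x₁ * x₂ - d * (x₃ * x₄)) + (x₂ * x₂ - d * (x₄ * x₄))
    expand₁₁ = solve-∀
    expand₁₂ : ∀ a d x₁ x₂ x₃ x₄ →
      (a * x₁ + x₂) * x₁ - d * ((a * x₃ + x₄) * x₃) ≡ a * (x₁ * x₁ - d * (x₃ * x₃)) + (x₁ * x₂ - d * (x₃ * x₄))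
    expand₁₂ = solve-∀

  unit-cancel : ∀ u v → u * u ≡ 1ℤ → u * v ≡ 0ℤ → v ≡ 0ℤ
  unit-cancel u v u²≡1 uv≡0 with i*j≡0⇒i≡0∨j≡0 u uv≡0
  ... | inj₂ v≡0 = v≡0
  ... | inj₁ u≡0 = contradiction (trans (sym u²≡1) (cong (λ w → w * w) u≡0)) λ ()

  unit-abs : ∀ u → u * u ≡ 1ℤ → ∣ u ∣ ≡ 1
  unit-abs u u²≡1 = ℕ.m*n≡1⇒m≡1 ∣ u ∣ ∣ u ∣ (trans (sym (abs-* u u)) (cong ∣_∣ u²≡1))

  -- Two matrices X = (x₁ x₂ ; x₃ x₄) and Y = (y₁ y₂ ; y₃ y₄) with the same Gram
  -- matrix, Y unimodular.  Then X · adj Y = (α β ; γ δ) preserves the form, so its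
  -- first column (α, γ) solves Pell's equation and is orthogonal to (β, δ).
  module Quotient (GX : HasGram d x₁ x₂ x₃ x₄ A B C) (GY : HasGram d y₁ y₂ y₃ y₄ A B C)
                  (unimodular : (y₁ * y₄ - y₂ * y₃) * (y₁ * y₄ - y₂ * y₃) ≡ 1ℤ) where

    α β γ δ D : ℤ
    α = x₁ * y₄ - x₂ * y₃
    β = x₂ * y₁ - x₁ * y₂
    γ = x₃ * y₄ - x₄ * y₃
    δ = x₄ * y₁ - x₃ * y₂
    D = y₁ * y₄ - y₂ * y₃

    norm-one : α * α - d * (γ * γ) ≡ 1ℤ
    norm-one = begin
      α * α - d * (γ * γ)                       ≡⟨ expand d x₁ x₂ x₃ x₄ y₃ y₄ ⟩
      q (x₁ * x₁ - d * (x₃ * x₃)) (x₁ * x₂ - d * (x₃ * x₄)) (x₂ * x₂ - d * (x₄ * x₄))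
                                                ≡⟨ gram-cong q GX ⟩
      q A B C                                   ≡⟨ gram-cong q GY ⟨
      q (y₁ * y₁ - d * (y₃ * y₃)) (y₁ * y₂ - d * (y₃ * y₄)) (y₂ * y₂ - d * (y₄ * y₄))
                                                ≡⟨ collapse d y₁ y₂ y₃ y₄ ⟩
      D * D                                     ≡⟨ unimodular ⟩
      1ℤ                                        ∎
      where
      q : ℤ → ℤ → ℤ → ℤ
      q u v w = y₄ * y₄ * u - + 2 * (y₃ * y₄) * v + y₃ * y₃ * w
      expand : ∀ d x₁ x₂ x₃ x₄ y₃ y₄ →
        (x₁ * y₄ - x₂ * y₃) * (x₁ * y₄ - x₂ * y₃) - d * ((x₃ * y₄ - x₄ * y₃) * (x₃ * y₄ - x₄ * y₃))
          ≡ y₄ * y₄ * (x₁ * x₁ - d * (x₃ * x₃)) - + 2 * (y₃ * y₄) * (x₁ * x₂ - d * (x₃ * x₄))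
            + y₃ * y₃ * (x₂ * x₂ - d * (x₄ * x₄))
      expand = solve-∀
      collapse : ∀ d y₁ y₂ y₃ y₄ →
        y₄ * y₄ * (y₁ * y₁ - d * (y₃ * y₃)) - + 2 * (y₃ * y₄) * (y₁ * y₂ - d * (y₃ * y₄))
          + y₃ * y₃ * (y₂ * y₂ - d * (y₄ * y₄)) ≡ (y₁ * y₄ - y₂ * y₃) * (y₁ * y₄ - y₂ * y₃)
      collapse = solve-∀

    orthogonal : α * β - d * (γ * δ) ≡ 0ℤ
    orthogonal = begin
      α * β - d * (γ * δ)                       ≡⟨ expand d x₁ x₂ x₃ x₄ y₁ y₂ y₃ y₄ ⟩
      b (x₁ * x₁ - d * (x₃ * x₃)) (x₁ * x₂ - d * (x₃ * x₄)) (x₂ * x₂ - d * (x₄ * x₄))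
                                                ≡⟨ gram-cong b GX ⟩
      b A B C                                   ≡⟨ gram-cong b GY ⟨
      b (y₁ * y₁ - d * (y₃ * y₃)) (y₁ * y₂ - d * (y₃ * y₄)) (y₂ * y₂ - d * (y₄ * y₄))
                                                ≡⟨ collapse d y₁ y₂ y₃ y₄ ⟩
      0ℤ                                        ∎
      where
      b : ℤ → ℤ → ℤ → ℤ
      b u v w = u * - (y₄ * y₂) + v * (y₄ * y₁ + y₂ * y₃) + w * - (y₃ * y₁)
      expand : ∀ d x₁ x₂ x₃ x₄ y₁ y₂ y₃ y₄ →
        (x₁ * y₄ - x₂ * y₃) * (x₂ * y₁ - x₁ * y₂) - d * ((x₃ * y₄ - x₄ * y₃) * (x₄ * y₁ - x₃ * y₂))
          ≡ (x₁ * x₁ - d * (x₃ * x₃)) * - (y₄ * y₂) + (x₁ * x₂ - d * (x₃ * x₄)) * (y₄ * y₁ + y₂ * y₃)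
            + (x₂ * x₂ - d * (x₄ * x₄)) * - (y₃ * y₁)
      expand = solve-∀
      collapse : ∀ d y₁ y₂ y₃ y₄ →
        (y₁ * y₁ - d * (y₃ * y₃)) * - (y₄ * y₂) + (y₁ * y₂ - d * (y₃ * y₄)) * (y₄ * y₁ + y₂ * y₃)
          + (y₂ * y₂ - d * (y₄ * y₄)) * - (y₃ * y₁) ≡ 0ℤ
      collapse = solve-∀

    -- If γ = 0 then α = ±1 and β = 0, so the first row of X is ± that of Y.
    trivial-quotient : γ ≡ 0ℤ → ∣ x₁ + x₂ ∣ ≡ ∣ y₁ + y₂ ∣
    trivial-quotient γ≡0 = begin
      ∣ x₁ + x₂ ∣             ≡⟨ ℕ.*-identityʳ _ ⟨
      ∣ x₁ + x₂ ∣ ℕ.* 1       ≡⟨ cong (∣ x₁ + x₂ ∣ ℕ.*_) (unit-abs D unimodular) ⟨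
      ∣ x₁ + x₂ ∣ ℕ.* ∣ D ∣   ≡⟨ abs-* (x₁ + x₂) D ⟨
      ∣ (x₁ + x₂) * D ∣       ≡⟨ cong ∣_∣ first-row ⟨
      ∣ α * (y₁ + y₂) ∣       ≡⟨ abs-* α (y₁ + y₂) ⟩
      ∣ α ∣ ℕ.* ∣ y₁ + y₂ ∣   ≡⟨ cong (ℕ._* ∣ y₁ + y₂ ∣) (unit-abs α α²≡1) ⟩
      1 ℕ.* ∣ y₁ + y₂ ∣       ≡⟨ ℕ.*-identityˡ _ ⟩
      ∣ y₁ + y₂ ∣             ∎
      where
      drop-γ : ∀ d u w → u - d * (+ 0 * w) ≡ u
      drop-γ = solve-∀
      α²≡1 : α * α ≡ 1ℤ
      α²≡1 = trans (sym (drop-γ d (α * α) 0ℤ)) (subst (λ g → α * α - d * (g * g) ≡ 1ℤ) γ≡0 norm-one)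
      αβ≡0 : α * β ≡ 0ℤ
      αβ≡0 = trans (sym (drop-γ d (α * β) δ)) (subst (λ g → α * β - d * (g * δ) ≡ 0ℤ) γ≡0 orthogonal)
      β≡0 : β ≡ 0ℤ
      β≡0 = unit-cancel α β α²≡1 αβ≡0
      row-identity : ∀ x₁ x₂ y₁ y₂ y₃ y₄ →
        (x₁ * y₄ - x₂ * y₃) * (y₁ + y₂) + (x₂ * y₁ - x₁ * y₂) * (y₃ + y₄) ≡ (x₁ + x₂) * (y₁ * y₄ - y₂ * y₃)
      row-identity = solve-∀
      drop-β : ∀ u v w → u * v + + 0 * w ≡ u * v
      drop-β = solve-∀
      first-row : α * (y₁ + y₂) ≡ (x₁ + x₂) * D
      first-row = begin
        α * (y₁ + y₂)                 ≡⟨ drop-β α (y₁ + y₂) (y₃ + y₄) ⟨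
        α * (y₁ + y₂) + 0ℤ * (y₃ + y₄) ≡⟨ cong (λ b → α * (y₁ + y₂) + b * (y₃ + y₄)) β≡0 ⟨
        α * (y₁ + y₂) + β * (y₃ + y₄)  ≡⟨ row-identity x₁ x₂ y₁ y₂ y₃ y₄ ⟩
        (x₁ + x₂) * D                 ∎

  -- The matrix M = (m₁ m₂ ; m₃ m₄) of determinant σ = ±1 carries the form
  -- x² − d z² to σ · (Q x² − 2 P x z − R z²): its Gram matrix is σ (Q −P ; −P −R).
  record Tracks (d σ P Q R m₁ m₂ m₃ m₄ : ℤ) : Set where
    field
      gram : HasGram d m₁ m₂ m₃ m₄ (σ * Q) (- (σ * P)) (- (σ * R))
      det  : m₁ * m₄ - m₂ * m₃ ≡ σ

  -- One step of the continued-fraction expansion: with partial quotient a,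
  -- P′ = a Q − P and Q′ = R + a P − a P′, the matrix M · (a 1 ; 1 0) tracks the
  -- next form (Q′, −2P′, −Q) with the opposite sign.
  tracks-step : ∀ {σ P Q R P′ Q′ m₁ m₂ m₃ m₄} a → Tracks d σ P Q R m₁ m₂ m₃ m₄ →
                P′ + P ≡ a * Q → Q′ + a * P′ ≡ R + a * P →
                Tracks d (- σ) P′ Q′ Q (a * m₁ + m₂) m₁ (a * m₃ + m₄) m₃
  tracks-step {σ = σ} {P} {Q} {R} {P′} {Q′} {m₁} {m₂} {m₃} {m₄} a T P′+P Q′+aP′ = record
    { gram = regram (sym new-R) (sym new-P) (negate-twice σ Q) (gram-step a (Tracks.gram T))
    ; det  = trans (det-step a m₁ m₂ m₃ m₄) (cong -_ (Tracks.det T))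
    }
    where
    solve-for : ∀ x y z → x + y ≡ z → x ≡ z - y
    solve-for x y z eq = trans (cancel x y) (cong (_- y) eq)
      where
      cancel : ∀ x y → x ≡ (x + y) - y
      cancel = solve-∀
    P′≡ : P′ ≡ a * Q - P
    P′≡ = solve-for P′ P (a * Q) P′+P
    new-R : (- σ) * Q′ ≡ a * a * (σ * Q) + + 2 * a * - (σ * P) + - (σ * R)
    new-R = begin
      (- σ) * Q′                              ≡⟨ cong ((- σ) *_) (solve-for Q′ (a * P′) (R + a * P) Q′+aP′) ⟩
      (- σ) * (R + a * P - a * P′)            ≡⟨ cong (λ p → (- σ) * (R + a * P - a * p)) P′≡ ⟩
      (- σ) * (R + a * P - a * (a * Q - P))   ≡⟨ expand σ a P Q R ⟩
      a * a * (σ * Q) + + 2 * a * - (σ * P) + - (σ * R) ∎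
      where
      expand : ∀ σ a P Q R →
        (- σ) * (R + a * P - a * (a * Q - P)) ≡ a * a * (σ * Q) + + 2 * a * - (σ * P) + - (σ * R)
      expand = solve-∀
    new-P : - ((- σ) * P′) ≡ a * (σ * Q) + - (σ * P)
    new-P = trans (cong (λ p → - ((- σ) * p)) P′≡) (expand σ a P Q)
      where
      expand : ∀ σ a P Q → - ((- σ) * (a * Q - P)) ≡ a * (σ * Q) + - (σ * P)
      expand = solve-∀
    negate-twice : ∀ σ Q → σ * Q ≡ - ((- σ) * Q)
    negate-twice = solve-∀
    det-step : ∀ a m₁ m₂ m₃ m₄ → (a * m₁ + m₂) * m₃ - m₁ * (a * m₃ + m₄) ≡ - (m₁ * m₄ - m₂ * m₃)
    det-step = solve-∀

module ReducedForms (d s : ℕ.ℕ) (s²<d : s ℕ.* s ℕ.< d) (d<[1+s]² : d ℕ.< ℕ.suc s ℕ.* ℕ.suc s) where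

  open import Data.Nat
  open import Data.Nat.Properties
  open import Data.Nat.DivMod using (_/_; _%_; m/n*n≤m; m≥n⇒m/n>0; m≡m%n+[m/n]*n; m%n<n)
  open import Data.Nat.Tactic.RingSolver using (solve-∀)
  open import Relation.Binary.PropositionalEquality

  -- The quadratic irrational (P + √d)/Q with P² + Q R = d is reduced when
  -- P ≤ s = ⌊√d⌋ and Q ≤ P + s; there are finitely many such (P, Q).
  record Reduced (P Q R : ℕ) : Set where
    field
      discriminant : P * P + Q * R ≡ d
      P≤s          : P ≤ s
      Q≤P+s        : Q ≤ P + s

  -- The continued-fraction step from (P, Q, R), Q = 1 + q: partial quotient
  -- a = ⌊(P + s)/Q⌋, then P′ = a Q − P and Q′ = R + a P − a P′ = (d − P′²)/Q.
  module Expansion (P q R : ℕ) where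
    Q a P′ Q′ : ℕ
    Q  = suc q
    a  = (P + s) / Q
    P′ = a * Q ∸ P
    Q′ = (R + a * P) ∸ a * P′

  module ExpansionStep {P q R : ℕ} (red : Reduced P (suc q) R) where
    open Reduced red
    open Expansion P q R public

    1≤a : 1 ≤ a
    1≤a = m≥n⇒m/n>0 Q≤P+s

    Q≤aQ : Q ≤ a * Q
    Q≤aQ = subst (_≤ a * Q) (*-identityˡ Q) (*-monoˡ-≤ Q 1≤a)

    P+s<aQ+Q : P + s < a * Q + Q
    P+s<aQ+Q = begin-strict
      P + s                ≡⟨ m≡m%n+[m/n]*n (P + s) Q ⟩
      (P + s) % Q + a * Q  <⟨ +-monoˡ-< (a * Q) (m%n<n (P + s) Q) ⟩
      Q + a * Q            ≡⟨ +-comm Q (a * Q) ⟩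
      a * Q + Q            ∎
      where open ≤-Reasoning

    -- if a Q < P then s < Q ≤ a Q < P ≤ s
    P≤aQ : P ≤ a * Q
    P≤aQ = ≮⇒≥ λ aQ<P → <-irrefl refl (begin-strict
      s       <⟨ +-cancelˡ-< P s Q (<-trans P+s<aQ+Q (+-monoˡ-< Q aQ<P)) ⟩
      Q       ≤⟨ Q≤aQ ⟩
      a * Q   <⟨ aQ<P ⟩
      P       ≤⟨ P≤s ⟩
      s       ∎)
      where open ≤-Reasoning

    P′+P≡aQ : P′ + P ≡ a * Q
    P′+P≡aQ = m∸n+n≡m P≤aQ

    P′≤s : P′ ≤ s
    P′≤s = +-cancelʳ-≤ P P′ s (begin
      P′ + P   ≡⟨ P′+P≡aQ ⟩
      a * Q    ≤⟨ m/n*n≤m (P + s) Q ⟩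
      P + s    ≡⟨ +-comm P s ⟩
      s + P    ∎)
      where open ≤-Reasoning

    s<P′+Q : s < P′ + Q
    s<P′+Q = +-cancelˡ-< P s (P′ + Q) (begin-strict
      P + s         <⟨ P+s<aQ+Q ⟩
      a * Q + Q     ≡⟨ cong (_+ Q) P′+P≡aQ ⟨
      P′ + P + Q    ≡⟨ cong (_+ Q) (+-comm P′ P) ⟩
      P + P′ + Q    ≡⟨ +-assoc P P′ Q ⟩
      P + (P′ + Q)  ∎)
      where open ≤-Reasoning

    -- Q (R + a P) = (d − P′²) + Q · a P′, written without subtraction
    shifted-discriminant : Q * (R + a * P) + P′ * P′ ≡ d + Q * (a * P′)
    shifted-discriminant = begin
      Q * (R + a * P) + P′ * P′           ≡⟨ regroup₁ Q R a P P′ ⟩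
      Q * R + (a * Q) * P + P′ * P′       ≡⟨ cong (λ z → Q * R + z * P + P′ * P′) P′+P≡aQ ⟨
      Q * R + (P′ + P) * P + P′ * P′      ≡⟨ regroup₂ Q R P P′ ⟩
      (P * P + Q * R) + (P′ + P) * P′     ≡⟨ cong₂ (λ u v → u + v * P′) discriminant P′+P≡aQ ⟩
      d + (a * Q) * P′                    ≡⟨ cong (d +_) (regroup₃ Q a P′) ⟩
      d + Q * (a * P′)                    ∎
      where
      open ≡-Reasoning
      regroup₁ : ∀ Q R a P P′ → Q * (R + a * P) + P′ * P′ ≡ Q * R + (a * Q) * P + P′ * P′
      regroup₁ = solve-∀
      regroup₂ : ∀ Q R P P′ → Q * R + (P′ + P) * P + P′ * P′ ≡ (P * P + Q * R) + (P′ + P) * P′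
      regroup₂ = solve-∀
      regroup₃ : ∀ Q a P′ → (a * Q) * P′ ≡ Q * (a * P′)
      regroup₃ = solve-∀

    -- Q′ > 0 because P′² ≤ s² < d
    aP′<R+aP : a * P′ < R + a * P
    aP′<R+aP = *-cancelˡ-< Q (a * P′) (R + a * P) (+-cancelʳ-< (P′ * P′) _ _ (begin-strict
      Q * (a * P′) + P′ * P′  <⟨ +-monoʳ-< (Q * (a * P′)) (≤-<-trans (*-mono-≤ P′≤s P′≤s) s²<d) ⟩
      Q * (a * P′) + d        ≡⟨ +-comm (Q * (a * P′)) d ⟩
      d + Q * (a * P′)        ≡⟨ shifted-discriminant ⟨
      Q * (R + a * P) + P′ * P′ ∎))
      where open ≤-Reasoning

    1≤Q′ : 1 ≤ Q′
    1≤Q′ = m<n⇒0<n∸m aP′<R+aP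

    Q′+aP′ : Q′ + a * P′ ≡ R + a * P
    Q′+aP′ = m∸n+n≡m (<⇒≤ aP′<R+aP)

    discriminant′ : P′ * P′ + Q′ * Q ≡ d
    discriminant′ = +-cancelʳ-≡ (Q * (a * P′)) _ _ (begin
      P′ * P′ + Q′ * Q + Q * (a * P′)    ≡⟨ regroup P′ Q′ Q (a * P′) ⟩
      Q * (Q′ + a * P′) + P′ * P′        ≡⟨ cong (λ z → Q * z + P′ * P′) Q′+aP′ ⟩
      Q * (R + a * P) + P′ * P′          ≡⟨ shifted-discriminant ⟩
      d + Q * (a * P′)                   ∎)
      where
      open ≡-Reasoning
      regroup : ∀ P′ Q′ Q x → P′ * P′ + Q′ * Q + Q * x ≡ Q * (Q′ + x) + P′ * P′
      regroup = solve-∀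

    -- if Q′ > P′ + s then, with t = s + 1 − P′ ≤ Q, d ≥ t (t + 2P′) + P′² = (s + 1)²
    Q′≤P′+s : Q′ ≤ P′ + s
    Q′≤P′+s = ≮⇒≥ λ P′+s<Q′ → <-irrefl refl (<-≤-trans d<[1+s]² (begin
      suc s * suc s               ≡⟨ cong₂ _*_ t+P′ t+P′ ⟨
      (t + P′) * (t + P′)         ≡⟨ square t P′ ⟩
      t * (P′ + (t + P′)) + P′ * P′ ≤⟨ +-monoˡ-≤ (P′ * P′) (*-mono-≤ t≤Q (bound P′+s<Q′)) ⟩
      Q * Q′ + P′ * P′            ≡⟨ cong (_+ P′ * P′) (*-comm Q Q′) ⟩
      Q′ * Q + P′ * P′            ≡⟨ +-comm (Q′ * Q) (P′ * P′) ⟩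
      P′ * P′ + Q′ * Q            ≡⟨ discriminant′ ⟩
      d                           ∎))
      where
      open ≤-Reasoning
      t : ℕ
      t = suc s ∸ P′
      t+P′ : t + P′ ≡ suc s
      t+P′ = m∸n+n≡m (m≤n⇒m≤1+n P′≤s)
      t≤Q : t ≤ Q
      t≤Q = +-cancelʳ-≤ P′ t Q (subst₂ _≤_ (sym t+P′) (+-comm P′ Q) s<P′+Q)
      bound : P′ + s < Q′ → P′ + (t + P′) ≤ Q′
      bound lt = subst (_≤ Q′) (trans (sym (+-suc P′ s)) (cong (P′ +_) (sym t+P′))) lt
      square : ∀ t P′ → (t + P′) * (t + P′) ≡ t * (P′ + (t + P′)) + P′ * P′
      square = solve-∀

    reduced′ : Reduced P′ Q′ Q
    reduced′ = record { discriminant = discriminant′ ; P≤s = P′≤s ; Q≤P+s = Q′≤P′+s }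

module ContinuedFraction (d s : ℕ.ℕ) (s²<d : s ℕ.* s ℕ.< d) (d<[1+s]² : d ℕ.< ℕ.suc s ℕ.* ℕ.suc s) where

  open import Data.Nat
  open import Data.Nat.Properties
  open import Data.Nat.Tactic.RingSolver using (solve-∀)
  import Data.Integer.Tactic.RingSolver as IntSolver
  open import Relation.Nullary using (contradiction)
  open import Data.Integer as ℤ using (ℤ; +_; 0ℤ)
  open import Data.Integer.Properties using (pos-*)
  open import Data.Fin as Fin using (Fin; toℕ; fromℕ<; combine)
  open import Data.Fin.Properties using (pigeonhole; combine-injective; fromℕ<-injective)
  open import Data.Product using (Σ; _×_; _,_; proj₁; ∃₂)
  open import Data.Sum using (inj₁; inj₂)
  open import Relation.Binary.PropositionalEquality
  open NormForm
  open ReducedForms d s s²<d d<[1+s]²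

  -- A stage of the expansion of √d: the form (P, 1 + q, R) together with the
  -- matrix (m₁ m₂ ; m₃ m₄) accumulating the partial quotients so far.
  record Stage : Set where
    constructor stage
    field P q R m₁ m₂ m₃ m₄ : ℕ

  -- A stage is valid with sign σ when its form is reduced and its matrix tracks
  -- it; m₁ ≥ 1 makes the matrix entries grow.
  record Valid (σ : ℤ) (c : Stage) : Set where
    open Stage c
    field
      reduced : Reduced P (suc q) R
      tracks  : Tracks (+ d) σ (+ P) (+ suc q) (+ R) (+ m₁) (+ m₂) (+ m₃) (+ m₄)
      1≤m₁    : 1 ≤ m₁

  lift-affine : ∀ a y x → + (a * y + x) ≡ (+ a) ℤ.* (+ y) ℤ.+ (+ x)
  lift-affine a y x = cong (ℤ._+ (+ x)) (pos-* a y)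

  lift-shift : ∀ x a y → + (x + a * y) ≡ (+ x) ℤ.+ (+ a) ℤ.* (+ y)
  lift-shift x a y = cong (λ z → (+ x) ℤ.+ z) (pos-* a y)

  tracks-next : ∀ {σ P Q R P′ Q′ m₁ m₂ m₃ m₄} a →
                Tracks (+ d) σ (+ P) (+ Q) (+ R) (+ m₁) (+ m₂) (+ m₃) (+ m₄) →
                P′ + P ≡ a * Q → Q′ + a * P′ ≡ R + a * P →
                Tracks (+ d) (ℤ.- σ) (+ P′) (+ Q′) (+ Q) (+ (a * m₁ + m₂)) (+ m₁) (+ (a * m₃ + m₄)) (+ m₃)
  tracks-next {σ} {P} {Q} {R} {P′} {Q′} {m₁} {m₂} {m₃} {m₄} a T P′+P Q′+aP′ =
    subst₂ (λ u v → Tracks (+ d) (ℤ.- σ) (+ P′) (+ Q′) (+ Q) u (+ m₁) v (+ m₃))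
           (sym (lift-affine a m₁ m₂)) (sym (lift-affine a m₃ m₄))
      (tracks-step (+ a) T (trans (cong +_ P′+P) (pos-* a Q))
                           (trans (sym (lift-shift Q′ a P′)) (trans (cong +_ Q′+aP′) (lift-shift R a P))))

  next : Stage → Stage
  next (stage P q R m₁ m₂ m₃ m₄) = stage P′ (pred Q′) Q (a * m₁ + m₂) m₁ (a * m₃ + m₄) m₃
    where open Expansion P q R

  next-valid : ∀ {σ} c → Valid σ c → Valid (ℤ.- σ) (next c)
  next-valid {σ} (stage P q R m₁ m₂ m₃ m₄) V = record
    { reduced = subst (λ Q″ → Reduced P′ Q″ Q) (sym Q′-positive) reduced′
    ; tracks  = subst (λ Q″ → Tracks (+ d) (ℤ.- σ) (+ P′) (+ Q″) (+ Q) (+ (a * m₁ + m₂)) (+ m₁) (+ (a * m₃ + m₄)) (+ m₃))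
                      (sym Q′-positive) (tracks-next a (Valid.tracks V) P′+P≡aQ Q′+aP′)
    ; 1≤m₁    = ≤-trans (*-mono-≤ 1≤a (Valid.1≤m₁ V)) (m≤m+n (a * m₁) m₂)
    }
    where
    open ExpansionStep (Valid.reduced V)
    Q′-positive : suc (pred Q′) ≡ Q′
    Q′-positive = suc-pred Q′ {{>-nonZero 1≤Q′}}

  size : Stage → ℕ
  size c = Stage.m₁ c + Stage.m₂ c

  next-grows : ∀ {σ} c → Valid σ c → size c < size (next c)
  next-grows (stage P q R m₁ m₂ m₃ m₄) V = begin-strict
    m₁ + m₂                <⟨ +-monoˡ-< m₂ (m<m+n m₁ (*-mono-≤ 1≤a (Valid.1≤m₁ V))) ⟩
    m₁ + a * m₁ + m₂       ≡⟨ rotate m₁ (a * m₁) m₂ ⟩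
    a * m₁ + m₂ + m₁       ∎
    where
    open ≤-Reasoning
    open ExpansionStep (Valid.reduced V)
    rotate : ∀ x y z → x + y + z ≡ y + z + x
    rotate = solve-∀

  ValidStage : Set
  ValidStage = Σ Stage (Valid (ℤ.- + 1))

  start : ValidStage
  start = stage s (pred Q₀) 1 s 1 1 0 , record
    { reduced = record
      { discriminant = trans (cong (λ Q → s * s + Q) (trans (*-identityʳ _) Q₀-positive)) s²+Q₀
      ; P≤s          = ≤-refl
      ; Q≤P+s        = subst (_≤ s + s) (sym Q₀-positive) Q₀≤s+s
      }
    ; tracks  = record
      { gram = record
        { gram₁₁ = start-gram₁₁
        ; gram₁₂ = initial₁₂ (+ d) (+ s)
        ; gram₂₂ = initial₂₂ (+ d)
        }
      ; det  = initial-det (+ s)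
      }
    ; 1≤m₁    = 1≤s
    }
    where
    Q₀ : ℕ
    Q₀ = d ∸ s * s
    s²+Q₀ : s * s + Q₀ ≡ d
    s²+Q₀ = m+[n∸m]≡n (<⇒≤ s²<d)
    Q₀-positive : suc (pred Q₀) ≡ Q₀
    Q₀-positive = suc-pred Q₀ {{>-nonZero (m<n⇒0<n∸m s²<d)}}
    start-gram₁₁ : (+ s) ℤ.* (+ s) ℤ.- (+ d) ℤ.* (+ 1 ℤ.* + 1) ≡ ℤ.- (+ 1) ℤ.* (+ suc (pred Q₀))
    start-gram₁₁ = begin
      (+ s) ℤ.* (+ s) ℤ.- (+ d) ℤ.* (+ 1 ℤ.* + 1)
        ≡⟨ cong (λ D → (+ s) ℤ.* (+ s) ℤ.- D ℤ.* (+ 1 ℤ.* + 1)) (trans (cong +_ (sym s²+Q₀)) (lift-affine s s Q₀)) ⟩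
      (+ s) ℤ.* (+ s) ℤ.- ((+ s) ℤ.* (+ s) ℤ.+ (+ Q₀)) ℤ.* (+ 1 ℤ.* + 1)
        ≡⟨ initial₁₁ (+ s) (+ Q₀) ⟩
      ℤ.- (+ 1) ℤ.* (+ Q₀)
        ≡⟨ cong (λ Q → ℤ.- (+ 1) ℤ.* (+ Q)) Q₀-positive ⟨
      ℤ.- (+ 1) ℤ.* (+ suc (pred Q₀)) ∎
      where
      open ≡-Reasoning
      initial₁₁ : ∀ x y → x ℤ.* x ℤ.- (x ℤ.* x ℤ.+ y) ℤ.* (+ 1 ℤ.* + 1) ≡ ℤ.- (+ 1) ℤ.* y
      initial₁₁ = IntSolver.solve-∀
    initial₁₂ : ∀ d x → x ℤ.* + 1 ℤ.- d ℤ.* (+ 1 ℤ.* + 0) ≡ ℤ.- (ℤ.- (+ 1) ℤ.* x)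
    initial₁₂ = IntSolver.solve-∀
    initial₂₂ : ∀ d → + 1 ℤ.* + 1 ℤ.- d ℤ.* (+ 0 ℤ.* + 0) ≡ ℤ.- (ℤ.- (+ 1) ℤ.* + 1)
    initial₂₂ = IntSolver.solve-∀
    initial-det : ∀ x → x ℤ.* + 0 ℤ.- + 1 ℤ.* + 1 ≡ ℤ.- + 1
    initial-det = IntSolver.solve-∀
    -- s = 0 would give 0 < d < 1
    1≤s : 1 ≤ s
    1≤s = positive-root s s²<d d<[1+s]²
      where
      positive-root : ∀ r → r * r < d → d < suc r * suc r → 1 ≤ r
      positive-root zero    0<d d<1 = contradiction (<-≤-trans 0<d (s≤s⁻¹ d<1)) (<-irrefl refl)
      positive-root (suc _) _   _   = s≤s z≤n
    Q₀≤s+s : Q₀ ≤ s + s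
    Q₀≤s+s = +-cancelˡ-≤ (s * s) Q₀ (s + s) (s≤s⁻¹ (begin-strict
      s * s + Q₀          ≡⟨ s²+Q₀ ⟩
      d                   <⟨ d<[1+s]² ⟩
      suc s * suc s       ≡⟨ expand s ⟩
      suc (s * s + (s + s)) ∎))
      where
      open ≤-Reasoning
      expand : ∀ s → suc s * suc s ≡ suc (s * s + (s + s))
      expand = solve-∀

  -- Two expansion steps restore the sign −1.
  step₂ : ValidStage → ValidStage
  step₂ (c , V) = next (next c) , next-valid (next c) (next-valid c V)

  orbit : ℕ → ValidStage
  orbit zero    = start
  orbit (suc n) = step₂ (orbit n)

  orbit-size : ℕ → ℕ
  orbit-size n = size (proj₁ (orbit n))

  step₂-grows : ∀ g → size (proj₁ g) < size (proj₁ (step₂ g))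
  step₂-grows (c , V) = <-trans (next-grows c V) (next-grows (next c) (next-valid c V))

  orbit-grows : ∀ {i j} → i < j → orbit-size i < orbit-size j
  orbit-grows {i} {suc j} i<1+j with m<1+n⇒m<n∨m≡n i<1+j
  ... | inj₁ i<j  = <-trans (orbit-grows i<j) (step₂-grows (orbit j))
  ... | inj₂ refl = step₂-grows (orbit i)

  -- The reduced pair (P, Q) of a stage lies in a finite set: P ≤ s and Q ≤ 2s.
  bound : ℕ
  bound = suc (s + s)

  index-P index-q : ValidStage → Fin bound
  index-P (stage P q R _ _ _ _ , V) = fromℕ< (s≤s (≤-trans P≤s (m≤m+n s s)))
    where open Reduced (Valid.reduced V)
  index-q (stage P q R _ _ _ _ , V) = fromℕ< (m≤n⇒m≤1+n (≤-trans Q≤P+s (+-monoˡ-≤ s P≤s)))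
    where open Reduced (Valid.reduced V)

  key : ValidStage → Fin (bound * bound)
  key g = combine (index-P g) (index-q g)

  -- Two valid stages with the same form (P, Q, R) but different sizes: the
  -- quotient of their matrices is a nontrivial automorph of x² − d z².
  same-form : ∀ {P q R m₁ m₂ m₃ m₄ n₁ n₂ n₃ n₄} →
              Valid (ℤ.- + 1) (stage P q R m₁ m₂ m₃ m₄) → Valid (ℤ.- + 1) (stage P q R n₁ n₂ n₃ n₄) →
              m₁ + m₂ < n₁ + n₂ → PellSolution (+ d)
  same-form V W m<n = α , γ , γ≢0 , norm-one
    where
    open Quotient (Tracks.gram (Valid.tracks W)) (Tracks.gram (Valid.tracks V))
                  (cong (λ D → D ℤ.* D) (Tracks.det (Valid.tracks V)))
    γ≢0 : γ ≢ 0ℤ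
    γ≢0 γ≡0 = <⇒≢ m<n (sym (trivial-quotient γ≡0))

  -- Equal keys give equal P and Q, hence equal R = (d − P²)/Q.
  collision : ∀ g h → size (proj₁ g) < size (proj₁ h) → key g ≡ key h → PellSolution (+ d)
  collision g@(stage P q R m₁ m₂ m₃ m₄ , V) h@(stage P′ q′ R′ n₁ n₂ n₃ n₄ , W) m<n same-key
    with combine-injective (index-P g) (index-q g) (index-P h) (index-q h) same-key
  ... | P-eq , q-eq
    with fromℕ<-injective P P′ _ _ P-eq | fromℕ<-injective q q′ _ _ q-eq
  ... | refl | refl
    with *-cancelˡ-≡ R R′ (suc q) (+-cancelˡ-≡ (P * P) _ _
           (trans (Reduced.discriminant (Valid.reduced V)) (sym (Reduced.discriminant (Valid.reduced W)))))
  ... | refl = same-form V W m<n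

  orbit-key : Fin (suc (bound * bound)) → Fin (bound * bound)
  orbit-key i = key (orbit (toℕ i))

  -- Among the first bound² + 1 stages of the orbit two share their key, and the
  -- later one is larger.
  pell : PellSolution (+ d)
  pell = repeated-key (pigeonhole (n<1+n (bound * bound)) orbit-key)
    where
    repeated-key : (∃₂ λ i j → i Fin.< j × orbit-key i ≡ orbit-key j) → PellSolution (+ d)
    repeated-key (i , j , i<j , same-key) =
      collision (orbit (toℕ i)) (orbit (toℕ j)) (orbit-grows {toℕ i} {toℕ j} i<j) same-key

module Squares where

  open import Data.Nat
  open import Data.Nat.Properties
  open import Data.Nat.DivMod using (_%_; m%n<n; %-distribˡ-*; [m+kn]%n≡m%n)
  open import Data.Product using (∃-syntax; _×_; _,_)
  open import Relation.Binary.PropositionalEquality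
  open import Relation.Nullary using (yes; no)
  open import Data.Integer using (+_)
  open NormForm using (PellSolution)

  floor-sqrt : ∀ n → ∃[ s ] (s * s ≤ n × n < suc s * suc s)
  floor-sqrt zero = 0 , z≤n , s≤s z≤n
  floor-sqrt (suc n) with floor-sqrt n
  ... | s , s²≤n , n<[1+s]² with suc n <? suc s * suc s
  ...   | yes n+1<[1+s]² = s , m≤n⇒m≤1+n s²≤n , n+1<[1+s]²
  ...   | no  n+1≮[1+s]² = suc s , ≮⇒≥ n+1≮[1+s]² ,
                           <-≤-trans (s≤s n<[1+s]²) (*-mono-< (n<1+n (suc s)) (n<1+n (suc s)))

  pell-nonsquare : ∀ d → (∀ r → r * r ≢ d) → PellSolution (+ d)
  pell-nonsquare d nonsquare with floor-sqrt d
  ... | s , s²≤d , d<[1+s]² = ContinuedFraction.pell d s (≤∧≢⇒< s²≤d (nonsquare s)) d<[1+s]²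

  square-mod-3 : ∀ r k → r * r ≢ 2 + 3 * k
  square-mod-3 r k r²≡2+3k = residue-square (r % 3) (m%n<n r 3) (begin
    (r % 3 * (r % 3)) % 3 ≡⟨ %-distribˡ-* r r 3 ⟨
    (r * r) % 3           ≡⟨ cong (_% 3) r²≡2+3k ⟩
    (2 + 3 * k) % 3       ≡⟨ cong (λ t → (2 + t) % 3) (*-comm 3 k) ⟩
    (2 + k * 3) % 3       ≡⟨ [m+kn]%n≡m%n 2 k 3 ⟩
    2                     ∎)
    where
    open ≡-Reasoning
    residue-square : ∀ t → t < 3 → (t * t) % 3 ≢ 2
    residue-square 0 _ ()
    residue-square 1 _ ()
    residue-square 2 _ ()
    residue-square (suc (suc (suc _))) (s≤s (s≤s (s≤s ()))) _

open import Defs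
open import Data.Integer using (ℤ; +_; _+_; _*_; _-_; _≤_; -_; -[1+_]; +≤+; ∣_∣)
open import Data.Integer.Properties using (pos-*; +-injective; ∣i∣≡0⇒i≡0)
open import Data.Integer.Tactic.RingSolver using (solve-∀)
import Data.Nat.Properties as ℕ
open import Data.Product using (_×_; ∃-syntax; _,_)
open import Relation.Binary.PropositionalEquality
open import Relation.Nullary using (¬_; contradiction)
open import Function.Bundles using (_⇔_; mk⇔)
open NormForm using (PellSolution)
open Squares using (pell-nonsquare; square-mod-3)
open ≡-Reasoning

Solvable : ℤ → Set
Solvable d = ∃[ x ] (x ≢ + 0 × ∃[ y ] (d * (x * x) + + 1 ≡ y * y))

solvable-from-pell : ∀ d → PellSolution d → Solvable d
solvable-from-pell d (α , γ , γ≢0 , α²-dγ²≡1) = γ , γ≢0 , α , (begin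
  d * (γ * γ) + + 1                       ≡⟨ cong (λ t → d * (γ * γ) + t) α²-dγ²≡1 ⟨
  d * (γ * γ) + (α * α - d * (γ * γ))     ≡⟨ cancel (d * (γ * γ)) (α * α) ⟩
  α * α                                   ∎)
  where
  cancel : ∀ u v → u + (v - u) ≡ v
  cancel = solve-∀

square-abs : ∀ i → i * i ≡ + (∣ i ∣ ℕ.* ∣ i ∣)
square-abs (+ n)    = sym (pos-* n n)
square-abs -[1+ n ] = refl

-- For c ≥ 2, −c x² + 1 = y² forces x = 0, as y² + c x² ≥ 2 otherwise.
unsolvable-below : ∀ c → ¬ Solvable (- + (2 ℕ.+ c))
unsolvable-below c (x , x≢0 , y , eq) = ℕ.<⇒≢ 1<Y+CX (+-injective (sym total))
  where
  C X Y : ℕ.ℕ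
  C = 2 ℕ.+ c
  X = ∣ x ∣ ℕ.* ∣ x ∣
  Y = ∣ y ∣ ℕ.* ∣ y ∣
  regroup : ∀ C X → (- C * X + + 1) + C * X ≡ + 1
  regroup = solve-∀
  total : + (Y ℕ.+ C ℕ.* X) ≡ + 1
  total = begin
    + (Y ℕ.+ C ℕ.* X)              ≡⟨ cong (λ t → + Y + t) (pos-* C X) ⟩
    + Y + + C * + X                ≡⟨ cong₂ (λ u v → u + + C * v) (square-abs y) (square-abs x) ⟨
    y * y + + C * (x * x)          ≡⟨ cong (λ t → t + + C * (x * x)) eq ⟨
    (- + C * (x * x) + + 1) + + C * (x * x) ≡⟨ regroup (+ C) (x * x) ⟩
    + 1                            ∎
  1≤X : 1 ℕ.≤ X
  1≤X with ∣ x ∣ in ∣x∣≡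
  ... | ℕ.zero  = contradiction (∣i∣≡0⇒i≡0 ∣x∣≡) x≢0
  ... | ℕ.suc _ = ℕ.s≤s ℕ.z≤n
  1<Y+CX : 1 ℕ.< Y ℕ.+ C ℕ.* X
  1<Y+CX = ℕ.≤-trans (ℕ.*-mono-≤ {2} {C} (ℕ.s≤s (ℕ.s≤s ℕ.z≤n)) 1≤X) (ℕ.m≤n+m (C ℕ.* X) Y)

-- 3m − 1 is the non-square 2 + 3k for m = 1 + k, and at most −4 for m < 0.
coefficient-positive : ∀ k → + 3 * + ℕ.suc k - + 1 ≡ + (2 ℕ.+ 3 ℕ.* k)
coefficient-positive k = trans (expand (+ k)) (cong (λ t → + 2 + t) (sym (pos-* 3 k)))
  where
  expand : ∀ x → + 3 * (+ 1 + x) - + 1 ≡ + 2 + + 3 * x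
  expand = solve-∀

coefficient-negative : ∀ n → + 3 * -[1+ n ] - + 1 ≡ - + (2 ℕ.+ (2 ℕ.+ 3 ℕ.* n))
coefficient-negative n = trans (expand (+ n)) (cong (λ t → - (+ 2 + (+ 2 + t))) (sym (pos-* 3 n)))
  where
  expand : ∀ x → + 3 * - (+ 1 + x) - + 1 ≡ - (+ 2 + (+ 2 + + 3 * x))
  expand = solve-∀

lemma5p3 : (m : ℤ) →
    (+ 0 ≤ m) ⇔ (∃[ x ] (x ≢ + 0 × ∃[ y ] ((+ 3 * m - + 1) * (x * x) + + 1 ≡ y * y)))
lemma5p3 m = mk⇔ (nonnegative⇒solvable m) (solvable⇒nonnegative m)
  where
  nonnegative⇒solvable : ∀ m → + 0 ≤ m → Solvable (+ 3 * m - + 1)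
  nonnegative⇒solvable (+ ℕ.zero)  _ = + 1 , (λ ()) , + 0 , refl
  nonnegative⇒solvable (+ ℕ.suc k) _ =
    subst Solvable (sym (coefficient-positive k))
      (solvable-from-pell (+ (2 ℕ.+ 3 ℕ.* k)) (pell-nonsquare (2 ℕ.+ 3 ℕ.* k) (λ r → square-mod-3 r k)))
  solvable⇒nonnegative : ∀ m → Solvable (+ 3 * m - + 1) → + 0 ≤ m
  solvable⇒nonnegative (+ n)    _   = +≤+ ℕ.z≤n
  solvable⇒nonnegative -[1+ n ] sol =
    contradiction (subst Solvable (coefficient-negative n) sol) (unsolvable-below (2 ℕ.+ 3 ℕ.* n))
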